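{- Let $G$ be a graph of order $n$, and write $I(G;x)=\sum_{k=0}^{\alpha(G)} s_k x^k$ and $I(G^*;x)=\sum_{k=0}^{\alpha(G^*)} t_k x^k$ (note $\alpha(G^*)=n$). Then: (i) $I(G^*;x)=\sum_{k=0}^{\alpha(G)} s_k x^k (1+x)^{n-k} = (1+x)^{\alpha(G^*)-\alpha(G)}\sum_{k=0}^{\alpha(G)} s_k x^k (1+x)^{\alpha(G)-k}$, and the coefficients are related by $$t_k=\sum_{j=0}^{k} s_j\binom{n-j}{n-k},\quad k\in\{0,1,\dots,n\},\qquad s_k=\sum_{j=0}^{k}(-1)^{k+j}\, t_j\binom{n-j}{n-k},\quad k\in\{0,1,\dots,\alpha(G)\},$$ where $s_j=0$ for $j>\alpha(G)$; in particular $t_0=1$ and $t_n=s_0+s_1+\dots+s_{\alpha(G)}$. (ii) $t_0\le t_1\le \dots\le t_j$, where $j=\lceil n/2\rceil$.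
   Context: All graphs are finite, simple, undirected. A stable set is a set of pairwise non-adjacent vertices; $\alpha(G)$ is the maximum size of a stable set of $G$. If $s_k$ denotes the number of stable sets of cardinality $k$ in $G$ (with $s_0=1$, counting the empty set), the independence polynomial is $I(G;x)=\sum_{k=0}^{\alpha(G)} s_k x^k$. For a graph $G$ with vertex set $\{v_1,\dots,v_n\}$, $G^*$ denotes the graph obtained from $G$ by adding $n$ new vertices $u_1,\dots,u_n$ and the edges $u_iv_i$ ($1\le i\le n$), i.e., appending a single pendant edge to each vertex of $G$. -}

module Defs where

open import Data.Bool using (Bool; true; false)
open import Data.Nat using (ℕ; zero; suc; _⊔_)
open import Data.Nat.Properties as ℕP using ()
open import Data.Integer as ℤ using (ℤ; +_)
open import Data.Fin using (Fin; splitAt)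
open import Data.Fin.Properties using (_≟_; all?)
open import Data.Fin.Subset using (Subset; _∈_; ∣_∣)
open import Data.Fin.Subset.Properties using (_∈?_)
open import Data.List using (List; []; _∷_; _++_; map; filter; length; foldr)
open import Data.Vec using (Vec; []; _∷_)
open import Data.Empty using (⊥-elim)
open import Data.Sum using (_⊎_; inj₁; inj₂)
open import Data.Product using (_×_)
open import Relation.Nullary using (Dec; ⌊_⌋; yes; no)
open import Relation.Nullary.Decidable using (_×-dec_; _→-dec_)
open import Relation.Binary.PropositionalEquality using (_≡_; refl)
open import Data.Bool.Properties using () renaming (_≟_ to _≟ᵇ_)

record Graph (n : ℕ) : Set where
  field
    adj    : Fin n → Fin n → Bool
    adj-sym    : ∀ i j → adj i j ≡ adj j i
    adj-irrefl : ∀ i → adj i i ≡ false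
open Graph public

Stable : ∀ {n} → Graph n → Subset n → Set
Stable G S = ∀ i → i ∈ S → ∀ j → j ∈ S → adj G i j ≡ false

stable? : ∀ {n} (G : Graph n) (S : Subset n) → Dec (Stable G S)
stable? G S = all? λ i → (i ∈? S) →-dec all? λ j → (j ∈? S) →-dec (adj G i j ≟ᵇ false)

allSubsets : ∀ n → List (Subset n)
allSubsets zero    = [] ∷ []
allSubsets (suc n) = map (false ∷_) (allSubsets n) ++ map (true ∷_) (allSubsets n)

stableCount : ∀ {n} → Graph n → ℕ → ℕ
stableCount {n} G k =
  length (filter (λ S → stable? G S ×-dec (∣ S ∣ ℕP.≟ k)) (allSubsets n))

α : ∀ {n} → Graph n → ℕ
α {n} G = foldr _⊔_ 0 (map ∣_∣ (filter (stable? G) (allSubsets n)))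

sumTo : ℕ → (ℕ → ℤ) → ℤ
sumTo zero    f = f 0
sumTo (suc m) f = sumTo m f ℤ.+ f (suc m)

sumToℕ : ℕ → (ℕ → ℕ) → ℕ
sumToℕ zero    f = f 0
sumToℕ (suc m) f = sumToℕ m f Data.Nat.+ f (suc m)

I : ∀ {n} → Graph n → ℤ → ℤ
I G x = sumTo (α G) (λ k → + stableCount G k ℤ.* (x ℤ.^ k))

-- G* : vertices Fin (n + n); the first copy (via splitAt) is V(G) = {v_i},
-- the second copy is the new vertices {u_i}; edges: those of G, plus u_i v_i.
private
  ⌊≟⌋-sym : ∀ {n} (i j : Fin n) → ⌊ i ≟ j ⌋ ≡ ⌊ j ≟ i ⌋
  ⌊≟⌋-sym i j with i ≟ j | j ≟ i
  ... | yes _ | yes _ = refl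
  ... | no _  | no _  = refl
  ... | yes refl | no ¬p = ⊥-elim (¬p refl)
  ... | no ¬p | yes refl = ⊥-elim (¬p refl)

  ⌊≟⌋-refl : ∀ {n} (i : Fin n) → ⌊ i ≟ i ⌋ ≡ true
  ⌊≟⌋-refl i with i ≟ i
  ... | yes _ = refl
  ... | no ¬p = ⊥-elim (¬p refl)

starAdj′ : ∀ {n} → Graph n → Fin n ⊎ Fin n → Fin n ⊎ Fin n → Bool
starAdj′ G (inj₁ i) (inj₁ j) = adj G i j
starAdj′ G (inj₁ i) (inj₂ j) = ⌊ i ≟ j ⌋
starAdj′ G (inj₂ i) (inj₁ j) = ⌊ i ≟ j ⌋
starAdj′ G (inj₂ i) (inj₂ j) = false

private
  starAdj′-sym : ∀ {n} (G : Graph n) x y → starAdj′ G x y ≡ starAdj′ G y x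
  starAdj′-sym G (inj₁ i) (inj₁ j) = adj-sym G i j
  starAdj′-sym G (inj₁ i) (inj₂ j) = ⌊≟⌋-sym i j
  starAdj′-sym G (inj₂ i) (inj₁ j) = ⌊≟⌋-sym i j
  starAdj′-sym G (inj₂ i) (inj₂ j) = refl

  starAdj′-irr : ∀ {n} (G : Graph n) x → starAdj′ G x x ≡ false
  starAdj′-irr G (inj₁ i) = adj-irrefl G i
  starAdj′-irr G (inj₂ i) = refl

star : ∀ {n} → Graph n → Graph (n Data.Nat.+ n)
star {n} G = record
  { adj    = λ x y → starAdj′ G (splitAt n x) (splitAt n y)
  ; adj-sym    = λ x y → starAdj′-sym G (splitAt n x) (splitAt n y)
  ; adj-irrefl = λ x → starAdj′-irr G (splitAt n x)
  }

-- A subset of V(G*) is a pair (A , B) of subsets of Fin n (A ⊆ {vᵢ}, B ⊆ {uᵢ}), and since uᵢ is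
-- adjacent only to vᵢ it is stable exactly when A is stable in G and B avoids A. So a stable set of
-- G* with k elements is a stable set A of G, say with j elements, together with a (k − j)-subset of
-- the n − j indices outside A: t_k = Σ_j s_j C(n−j, k−j) = Σ_j s_j C(n−j, n−k), and weighting by
-- x^|S| instead gives I(G*;x) = Σ_j s_j x^j (1+x)^(n−j). The formula for s_k is binomial inversion,
-- resting on C(n−l, n−j) C(n−j, n−k) = C(n−l, n−k) C(k−l, k−j) and Σ_i (−1)^i C(m, i) = 0^m.
-- For 2i + 1 ≤ n every C(n−j, n−i) is at most C(n−j, n−i−1), because binomial coefficients
-- decrease past the middle; hence t_i ≤ t_{i+1} term by term.

module Submission where

open import Defs
open import Data.Bool using (Bool; true; false; _∧_; T)
open import Data.List as List using (List; []; _∷_; map; filter; length; foldr)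
open import Data.Vec as Vec using ([]; _∷_; _++_; here; there)
import Data.Nat as ℕ
open import Data.Nat using (ℕ; zero; suc; _≤_; _<_; _∸_; _!; ⌈_/2⌉; NonZero; z≤n; s≤s)
import Data.Nat.Properties as ℕP
open import Data.Nat.Properties using (_!≢0; _!*_!≢0)
open import Data.Integer as ℤ using (ℤ; +_; -_; _*_; _^_; _+_; 0ℤ)
import Data.Integer.Properties as ℤP
open import Data.Sum using (_⊎_; inj₁; inj₂; [_,_]′)
open import Data.Product using (_×_; _,_; proj₂)
open import Data.Fin using (Fin; splitAt; join; _↑ˡ_; _↑ʳ_)
import Data.Fin.Properties as FinP
open import Data.Empty using (⊥-elim)
open import Data.Fin.Subset using (Subset; ∣_∣; _∈_; ∁) renaming (⊥ to ∅; ⊤ to full)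
open import Data.Fin.Subset.Properties using (∣p∣≤n; ∣∁p∣≡n∸∣p∣; ∣⊥∣≡0; ∣⊤∣≡n; ∉⊥)
open import Data.Nat.Combinatorics
  using (_C_; nCk≡nC[n∸k]; k>n⇒nCk≡0; nCk+nC[k+1]≡[n+1]C[k+1]; nCk≡n!/k![n-k]!; k![n∸k]!∣n!; nCn≡1; nC1≡n)
open import Data.Nat.DivMod using (m/n*n≡m)
import Data.Nat.Tactic.RingSolver as ℕ-Ring
open import Data.Integer.Tactic.RingSolver using (solve-∀)
open import Function.Bundles using (_⇔_; mk⇔)
open import Data.List.Membership.Propositional using () renaming (_∈_ to _∈ₗ_)
import Data.List.Membership.Propositional.Properties as ∈ₗ
open import Data.List.Relation.Unary.Any using (here; there)
open import Data.List.Relation.Unary.All as All using (All; []; _∷_)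
open import Data.List.Relation.Unary.All.Properties using (all-filter; map⁺)
open import Data.List.Properties using (filter-none)
open import Relation.Nullary using (Dec; does; ¬_; ⌊_⌋)
open import Relation.Nullary.Decidable using (dec-true; dec-false; does-⇔; isYes≗does; fromWitness; T?; _×-dec_)
open import Relation.Binary.PropositionalEquality
open ≡-Reasoning
import Algebra.Properties.CommutativeSemigroup as CommSemigroupProperties

private
  module ℤ+ = CommSemigroupProperties ℤP.+-commutativeSemigroup
  module ℤ* = CommSemigroupProperties ℤP.*-commutativeSemigroup

𝟙 : Bool → ℤ
𝟙 true  = + 1
𝟙 false = + 0

𝟙-∧ : ∀ a b → 𝟙 (a ∧ b) ≡ 𝟙 a * 𝟙 b
𝟙-∧ true  b = sym (ℤP.*-identityˡ (𝟙 b))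
𝟙-∧ false b = refl

sumOver : ∀ {A : Set} → List A → (A → ℤ) → ℤ
sumOver []       f = + 0
sumOver (x ∷ xs) f = f x + sumOver xs f

infix 5 sumOver
syntax sumOver xs (λ x → e) = ∑[ x ∈ xs ] e

module _ {A : Set} where

  sumOver-++ : ∀ (xs ys : List A) f → sumOver (xs List.++ ys) f ≡ sumOver xs f + sumOver ys f
  sumOver-++ []       ys f = sym (ℤP.+-identityˡ _)
  sumOver-++ (x ∷ xs) ys f = trans (cong (_+_ (f x)) (sumOver-++ xs ys f)) (sym (ℤP.+-assoc (f x) _ _))

  sumOver-map : ∀ {B : Set} (g : B → A) xs f → sumOver (map g xs) f ≡ sumOver xs (λ x → f (g x))
  sumOver-map g []       f = refl
  sumOver-map g (x ∷ xs) f = cong (_+_ (f (g x))) (sumOver-map g xs f)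

  sumOver-cong : ∀ (xs : List A) {f g} → (∀ x → f x ≡ g x) → sumOver xs f ≡ sumOver xs g
  sumOver-cong []       f≗g = refl
  sumOver-cong (x ∷ xs) f≗g = cong₂ _+_ (f≗g x) (sumOver-cong xs f≗g)

  sumOver-zero : ∀ (xs : List A) {f} → (∀ x → f x ≡ + 0) → sumOver xs f ≡ + 0
  sumOver-zero []       f≗0 = refl
  sumOver-zero (x ∷ xs) f≗0 = cong₂ _+_ (f≗0 x) (sumOver-zero xs f≗0)

  sumOver-*ˡ : ∀ (xs : List A) c f → ∑[ x ∈ xs ] c * f x ≡ c * sumOver xs f
  sumOver-*ˡ []       c f = sym (ℤP.*-zeroʳ c)
  sumOver-*ˡ (x ∷ xs) c f = trans (cong (_+_ (c * f x)) (sumOver-*ˡ xs c f)) (sym (ℤP.*-distribˡ-+ c (f x) _))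

  sumOver-*ʳ : ∀ (xs : List A) c f → ∑[ x ∈ xs ] f x * c ≡ sumOver xs f * c
  sumOver-*ʳ xs c f = begin
    ∑[ x ∈ xs ] f x * c ≡⟨ sumOver-cong xs (λ x → ℤP.*-comm (f x) c) ⟩
    ∑[ x ∈ xs ] c * f x ≡⟨ sumOver-*ˡ xs c f ⟩
    c * sumOver xs f    ≡⟨ ℤP.*-comm c _ ⟩
    sumOver xs f * c    ∎

  length-filter : ∀ {P : A → Set} (P? : ∀ x → Dec (P x)) xs →
    + length (filter P? xs) ≡ ∑[ x ∈ xs ] 𝟙 (does (P? x))
  length-filter P? []       = refl
  length-filter P? (x ∷ xs) with does (P? x)
  ... | true  = cong (_+_ (+ 1)) (length-filter P? xs)
  ... | false = trans (length-filter P? xs) (sym (ℤP.+-identityˡ _))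

sumTo-cong : ∀ m {f g : ℕ → ℤ} → (∀ j → j ≤ m → f j ≡ g j) → sumTo m f ≡ sumTo m g
sumTo-cong zero    f≗g = f≗g 0 z≤n
sumTo-cong (suc m) f≗g =
  cong₂ _+_ (sumTo-cong m (λ j j≤m → f≗g j (ℕP.m≤n⇒m≤1+n j≤m))) (f≗g (suc m) ℕP.≤-refl)

sumTo-zero : ∀ m {f : ℕ → ℤ} → (∀ j → j ≤ m → f j ≡ + 0) → sumTo m f ≡ + 0
sumTo-zero zero    f≗0 = f≗0 0 z≤n
sumTo-zero (suc m) f≗0 =
  cong₂ _+_ (sumTo-zero m (λ j j≤m → f≗0 j (ℕP.m≤n⇒m≤1+n j≤m))) (f≗0 (suc m) ℕP.≤-refl)

sumTo-+ : ∀ m (f g : ℕ → ℤ) → sumTo m (λ j → f j + g j) ≡ sumTo m f + sumTo m g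
sumTo-+ zero    f g = refl
sumTo-+ (suc m) f g = trans (cong (_+ (f (suc m) + g (suc m))) (sumTo-+ m f g))
                            (ℤ+.interchange (sumTo m f) (sumTo m g) (f (suc m)) (g (suc m)))

sumTo-*ˡ : ∀ m c (f : ℕ → ℤ) → sumTo m (λ j → c * f j) ≡ c * sumTo m f
sumTo-*ˡ zero    c f = refl
sumTo-*ˡ (suc m) c f = trans (cong (_+ c * f (suc m)) (sumTo-*ˡ m c f)) (sym (ℤP.*-distribˡ-+ c _ _))

sumTo-*ʳ : ∀ m c (f : ℕ → ℤ) → sumTo m (λ j → f j * c) ≡ sumTo m f * c
sumTo-*ʳ m c f = begin
  sumTo m (λ j → f j * c) ≡⟨ sumTo-cong m (λ j _ → ℤP.*-comm (f j) c) ⟩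
  sumTo m (λ j → c * f j) ≡⟨ sumTo-*ˡ m c f ⟩
  c * sumTo m f           ≡⟨ ℤP.*-comm c _ ⟩
  sumTo m f * c           ∎

sumTo-truncate : ∀ {m M} (f : ℕ → ℤ) → m ≤ M → (∀ j → m < j → j ≤ M → f j ≡ + 0) →
  sumTo M f ≡ sumTo m f
sumTo-truncate {M = zero}  f z≤n     f≗0 = refl
sumTo-truncate {m} {suc M} f m≤1+M f≗0 with ℕP.m≤n⇒m<n∨m≡n m≤1+M
... | inj₂ refl = refl
... | inj₁ m<1+M = begin
  sumTo M f + f (suc M)
    ≡⟨ cong₂ _+_ (sumTo-truncate f (ℕP.m<1+n⇒m≤n m<1+M) (λ j m<j j≤M → f≗0 j m<j (ℕP.m≤n⇒m≤1+n j≤M)))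
                 (f≗0 (suc M) m<1+M ℕP.≤-refl) ⟩
  sumTo m f + + 0
    ≡⟨ ℤP.+-identityʳ _ ⟩
  sumTo m f ∎

sumTo-swap : ∀ m k (f : ℕ → ℕ → ℤ) →
  sumTo m (λ i → sumTo k (f i)) ≡ sumTo k (λ j → sumTo m (λ i → f i j))
sumTo-swap zero    k f = refl
sumTo-swap (suc m) k f = trans (cong (_+ sumTo k (f (suc m))) (sumTo-swap m k f))
                               (sym (sumTo-+ k (λ j → sumTo m (λ i → f i j)) (f (suc m))))

sumTo-suc : ∀ m (f : ℕ → ℤ) → sumTo (suc m) f ≡ f 0 + sumTo m (λ j → f (suc j))
sumTo-suc zero    f = refl
sumTo-suc (suc m) f = trans (cong (_+ f (suc (suc m))) (sumTo-suc m f)) (ℤP.+-assoc (f 0) _ _)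

sumTo-reverse : ∀ m (f : ℕ → ℤ) → sumTo m (λ j → f (m ∸ j)) ≡ sumTo m f
sumTo-reverse zero    f = refl
sumTo-reverse (suc m) f = begin
  sumTo (suc m) (λ j → f (suc m ∸ j)) ≡⟨ sumTo-suc m (λ j → f (suc m ∸ j)) ⟩
  f (suc m) + sumTo m (λ j → f (m ∸ j)) ≡⟨ cong (_+_ (f (suc m))) (sumTo-reverse m f) ⟩
  f (suc m) + sumTo m f                 ≡⟨ ℤP.+-comm (f (suc m)) _ ⟩
  sumTo m f + f (suc m)                 ∎

sumTo-δ : ∀ {a} N (h : ℕ → ℤ) → a ≤ N → sumTo N (λ j → 𝟙 (does (a ℕP.≟ j)) * h j) ≡ h a
sumTo-δ zero h z≤n = ℤP.*-identityˡ (h 0)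
sumTo-δ {a} (suc N) h a≤1+N with ℕP.m≤n⇒m<n∨m≡n a≤1+N
... | inj₁ a<1+N = begin
  sumTo N (λ j → 𝟙 (does (a ℕP.≟ j)) * h j) + 𝟙 (does (a ℕP.≟ suc N)) * h (suc N)
    ≡⟨ cong₂ _+_ (sumTo-δ N h (ℕP.m<1+n⇒m≤n a<1+N))
                 (cong (λ b → 𝟙 b * h (suc N)) (dec-false (a ℕP.≟ suc N) (ℕP.<⇒≢ a<1+N))) ⟩
  h a + + 0
    ≡⟨ ℤP.+-identityʳ (h a) ⟩
  h a ∎
... | inj₂ refl = begin
  sumTo N (λ j → 𝟙 (does (suc N ℕP.≟ j)) * h j) + 𝟙 (does (suc N ℕP.≟ suc N)) * h (suc N)
    ≡⟨ cong₂ _+_ (sumTo-zero N (λ j j≤N → cong (λ b → 𝟙 b * h j)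
                                   (dec-false (suc N ℕP.≟ j) (ℕP.>⇒≢ (s≤s j≤N)))))
                 (cong (λ b → 𝟙 b * h (suc N)) (dec-true (suc N ℕP.≟ suc N) refl)) ⟩
  + 0 + + 1 * h (suc N)
    ≡⟨ trans (ℤP.+-identityˡ _) (ℤP.*-identityˡ _) ⟩
  h (suc N) ∎

sumOver-sumTo : ∀ {A : Set} (xs : List A) N (f : A → ℕ → ℤ) →
  ∑[ x ∈ xs ] sumTo N (f x) ≡ sumTo N (λ j → ∑[ x ∈ xs ] f x j)
sumOver-sumTo []       N f = sym (sumTo-zero N (λ _ _ → refl))
sumOver-sumTo (x ∷ xs) N f = trans (cong (_+_ (sumTo N (f x))) (sumOver-sumTo xs N f))
                                   (sym (sumTo-+ N (f x) _))

sumToℕ-to-ℤ : ∀ m (f : ℕ → ℕ) → + sumToℕ m f ≡ sumTo m (λ j → + f j)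
sumToℕ-to-ℤ zero    f = refl
sumToℕ-to-ℤ (suc m) f = trans (ℤP.pos-+ (sumToℕ m f) _) (cong (_+ + f (suc m)) (sumToℕ-to-ℤ m f))

sumToℕ-mono-≤ : ∀ m {f g : ℕ → ℕ} → (∀ j → j ≤ m → f j ≤ g j) → sumToℕ m f ≤ sumToℕ m g
sumToℕ-mono-≤ zero    f≤g = f≤g 0 z≤n
sumToℕ-mono-≤ (suc m) f≤g =
  ℕP.+-mono-≤ (sumToℕ-mono-≤ m (λ j j≤m → f≤g j (ℕP.m≤n⇒m≤1+n j≤m))) (f≤g (suc m) ℕP.≤-refl)

n∸l≡[n∸k]+[k∸l] : ∀ {l k n} → l ≤ k → k ≤ n → n ∸ l ≡ (n ∸ k) ℕ.+ (k ∸ l)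
n∸l≡[n∸k]+[k∸l] {l} {k} {n} l≤k k≤n =
  trans (cong (_∸ l) (sym (ℕP.m∸n+n≡m k≤n))) (ℕP.+-∸-assoc (n ∸ k) l≤k)

[n∸a]∸[k∸a]≡n∸k : ∀ n {a k} → a ≤ k → (n ∸ a) ∸ (k ∸ a) ≡ n ∸ k
[n∸a]∸[k∸a]≡n∸k n {a} a≤k = trans (ℕP.∸-+-assoc n a _) (cong (n ∸_) (ℕP.m+[n∸m]≡n a≤k))

[n∸l]∸[n∸k]≡k∸l : ∀ {l k n} → l ≤ k → k ≤ n → (n ∸ l) ∸ (n ∸ k) ≡ k ∸ l
[n∸l]∸[n∸k]≡k∸l {l} {k} {n} l≤k k≤n =
  trans (cong (_∸ (n ∸ k)) (n∸l≡[n∸k]+[k∸l] l≤k k≤n)) (ℕP.m+n∸m≡n (n ∸ k) (k ∸ l))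

<⌈n/2⌉⇒1+i+i≤n : ∀ n i → i < ⌈ n /2⌉ → suc i ℕ.+ i ≤ n
<⌈n/2⌉⇒1+i+i≤n (suc zero)    zero    _           = s≤s z≤n
<⌈n/2⌉⇒1+i+i≤n (suc zero)    (suc i) (s≤s ())
<⌈n/2⌉⇒1+i+i≤n (suc (suc n)) zero    _           = s≤s z≤n
<⌈n/2⌉⇒1+i+i≤n (suc (suc n)) (suc i) (s≤s i<⌈n/2⌉) =
  s≤s (subst (_≤ suc n) (cong suc (sym (ℕP.+-suc i i))) (s≤s (<⌈n/2⌉⇒1+i+i≤n n i i<⌈n/2⌉)))

nCk*k!*[n∸k]!≡n! : ∀ {n k} → k ≤ n → (n C k) ℕ.* (k ! ℕ.* (n ∸ k) !) ≡ n !
nCk*k!*[n∸k]!≡n! {n} {k} k≤n =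
  trans (cong (ℕ._* (k ! ℕ.* (n ∸ k) !)) (nCk≡n!/k![n-k]! k≤n)) (m/n*n≡m (k![n∸k]!∣n! k≤n))
  where instance _ = k !* (n ∸ k) !≢0

nCk*kCj≡nCj*[n∸j]C[k∸j] : ∀ {n k j} → j ≤ k → k ≤ n →
  (n C k) ℕ.* (k C j) ≡ (n C j) ℕ.* ((n ∸ j) C (k ∸ j))
nCk*kCj≡nCj*[n∸j]C[k∸j] {n} {k} {j} j≤k k≤n =
  ℕP.*-cancelʳ-≡ _ _ (j ! ℕ.* ((k ∸ j) ! ℕ.* (n ∸ k) !)) (begin
  (n C k) ℕ.* (k C j) ℕ.* (j ! ℕ.* ((k ∸ j) ! ℕ.* (n ∸ k) !))
    ≡⟨ regroupˡ (n C k) (k C j) (j !) ((k ∸ j) !) ((n ∸ k) !) ⟩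
  (n C k) ℕ.* ((k C j) ℕ.* (j ! ℕ.* (k ∸ j) !) ℕ.* (n ∸ k) !)
    ≡⟨ cong (λ m → (n C k) ℕ.* (m ℕ.* (n ∸ k) !)) (nCk*k!*[n∸k]!≡n! j≤k) ⟩
  (n C k) ℕ.* (k ! ℕ.* (n ∸ k) !)
    ≡⟨ nCk*k!*[n∸k]!≡n! k≤n ⟩
  n !
    ≡⟨ nCk*k!*[n∸k]!≡n! (ℕP.≤-trans j≤k k≤n) ⟨
  (n C j) ℕ.* (j ! ℕ.* (n ∸ j) !)
    ≡⟨ cong (λ m → (n C j) ℕ.* (j ! ℕ.* m)) (nCk*k!*[n∸k]!≡n! (ℕP.∸-monoˡ-≤ j k≤n)) ⟨
  (n C j) ℕ.* (j ! ℕ.* (((n ∸ j) C (k ∸ j)) ℕ.* ((k ∸ j) ! ℕ.* ((n ∸ j) ∸ (k ∸ j)) !)))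
    ≡⟨ cong (λ m → (n C j) ℕ.* (j ! ℕ.* (((n ∸ j) C (k ∸ j)) ℕ.* ((k ∸ j) ! ℕ.* m !))))
            ([n∸a]∸[k∸a]≡n∸k n j≤k) ⟩
  (n C j) ℕ.* (j ! ℕ.* (((n ∸ j) C (k ∸ j)) ℕ.* ((k ∸ j) ! ℕ.* (n ∸ k) !)))
    ≡⟨ regroupʳ (n C j) ((n ∸ j) C (k ∸ j)) (j !) ((k ∸ j) !) ((n ∸ k) !) ⟩
  (n C j) ℕ.* ((n ∸ j) C (k ∸ j)) ℕ.* (j ! ℕ.* ((k ∸ j) ! ℕ.* (n ∸ k) !)) ∎)
  where
  instance
    _ : NonZero (j ! ℕ.* ((k ∸ j) ! ℕ.* (n ∸ k) !))
    _ = ℕP.m*n≢0 (j !) _ {{j !≢0}} {{(k ∸ j) !* (n ∸ k) !≢0}}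
  regroupˡ : ∀ a b c d e → a ℕ.* b ℕ.* (c ℕ.* (d ℕ.* e)) ≡ a ℕ.* (b ℕ.* (c ℕ.* d) ℕ.* e)
  regroupˡ = ℕ-Ring.solve-∀
  regroupʳ : ∀ a b c d e → a ℕ.* (c ℕ.* (b ℕ.* (d ℕ.* e))) ≡ a ℕ.* b ℕ.* (c ℕ.* (d ℕ.* e))
  regroupʳ = ℕ-Ring.solve-∀

[k+1]C[k]≡k+1 : ∀ k → suc k C k ≡ suc k
[k+1]C[k]≡k+1 k = begin
  suc k C k               ≡⟨ nCk≡nC[n∸k] (ℕP.n≤1+n k) ⟩
  suc k C (suc k ∸ k)     ≡⟨ cong (suc k C_) (ℕP.m+n∸n≡m 1 k) ⟩
  suc k C 1               ≡⟨ nC1≡n (suc k) ⟩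
  suc k                   ∎

nC[k+1]≤nCk : ∀ {m a} → m ≤ suc (a ℕ.+ a) → m C suc a ≤ m C a
nC[k+1]≤nCk {m} {a} m≤2a+1 with ℕP.≤-<-connex m a
... | inj₁ m≤a = ℕP.≤-trans (ℕP.≤-reflexive (k>n⇒nCk≡0 (s≤s m≤a))) z≤n
... | inj₂ a<m = ℕP.*-cancelʳ-≤ (m C suc a) (m C a) (suc a)
  (subst (ℕ._≤ (m C a) ℕ.* suc a) (sym absorption) (ℕP.*-monoʳ-≤ (m C a) m∸a≤1+a))
  where
  absorption : (m C suc a) ℕ.* suc a ≡ (m C a) ℕ.* (m ∸ a)
  absorption = begin
    (m C suc a) ℕ.* suc a             ≡⟨ cong ((m C suc a) ℕ.*_) ([k+1]C[k]≡k+1 a) ⟨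
    (m C suc a) ℕ.* (suc a C a)         ≡⟨ nCk*kCj≡nCj*[n∸j]C[k∸j] (ℕP.n≤1+n a) a<m ⟩
    (m C a) ℕ.* ((m ∸ a) C (suc a ∸ a)) ≡⟨ cong (λ r → (m C a) ℕ.* ((m ∸ a) C r)) (ℕP.m+n∸n≡m 1 a) ⟩
    (m C a) ℕ.* ((m ∸ a) C 1)           ≡⟨ cong ((m C a) ℕ.*_) (nC1≡n (m ∸ a)) ⟩
    (m C a) ℕ.* (m ∸ a)               ∎
  m∸a≤1+a : m ∸ a ≤ suc a
  m∸a≤1+a = subst (m ∸ a ≤_) (ℕP.m+n∸n≡m (suc a) a) (ℕP.∸-monoˡ-≤ a m≤2a+1)

C-step-down : ∀ {n i} j → suc i ℕ.+ i ≤ n → (n ∸ j) C (n ∸ i) ≤ (n ∸ j) C (n ∸ suc i)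
C-step-down {n} {i} j 1+2i≤n =
  subst (λ r → (n ∸ j) C r ≤ (n ∸ j) C a) (sym n∸i≡1+a)
        (nC[k+1]≤nCk (ℕP.≤-trans (ℕP.m∸n≤m n j) n≤1+2a))
  where
  a = n ∸ suc i
  i<n : suc i ≤ n
  i<n = ℕP.≤-trans (ℕP.m≤m+n (suc i) i) 1+2i≤n
  n∸i≡1+a : n ∸ i ≡ suc a
  n∸i≡1+a = ℕP.+-∸-assoc 1 i<n
  i≤a : i ≤ a
  i≤a = subst (_≤ a) (ℕP.m+n∸m≡n (suc i) i) (ℕP.∸-monoˡ-≤ (suc i) 1+2i≤n)
  n≤1+2a : n ≤ suc (a ℕ.+ a)
  n≤1+2a = subst (_≤ suc (a ℕ.+ a)) (ℕP.m+[n∸m]≡n i<n) (s≤s (ℕP.+-monoˡ-≤ a i≤a))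

alternating-binomial-sum : ∀ m → sumTo m (λ i → (- + 1) ^ i * + (m C i)) ≡ 0ℤ ^ m
alternating-binomial-sum zero    = refl
alternating-binomial-sum (suc m) = begin
  sumTo (suc m) (λ i → (- + 1) ^ i * + (suc m C i))
    ≡⟨ sumTo-suc m _ ⟩
  + 1 + sumTo m (λ i → (- + 1) ^ suc i * + (suc m C suc i))
    ≡⟨ cong (_+_ (+ 1)) (sumTo-cong m (λ i _ → pascal i)) ⟩
  + 1 + sumTo m (λ i → - + 1 * ((- + 1) ^ i * + (m C i)) + (- + 1) ^ suc i * + (m C suc i))
    ≡⟨ cong (_+_ (+ 1)) (sumTo-+ m _ _) ⟩
  + 1 + (sumTo m (λ i → - + 1 * ((- + 1) ^ i * + (m C i))) + B)
    ≡⟨ cong (λ r → + 1 + (r + B)) (sumTo-*ˡ m (- + 1) _) ⟩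
  + 1 + (- + 1 * A + B)
    ≡⟨ cong (λ r → + 1 + (- + 1 * r + B)) A≡1+B ⟩
  + 1 + (- + 1 * (+ 1 + B) + B)
    ≡⟨ cancel B ⟩
  + 0 ∎
  where
  A = sumTo m (λ i → (- + 1) ^ i * + (m C i))
  B = sumTo m (λ i → (- + 1) ^ suc i * + (m C suc i))
  pascal : ∀ i → (- + 1) ^ suc i * + (suc m C suc i)
               ≡ - + 1 * ((- + 1) ^ i * + (m C i)) + (- + 1) ^ suc i * + (m C suc i)
  pascal i = begin
    (- + 1) ^ suc i * + (suc m C suc i)
      ≡⟨ cong (λ c → (- + 1) ^ suc i * + c) (nCk+nC[k+1]≡[n+1]C[k+1] m i) ⟨
    (- + 1) ^ suc i * + (m C i ℕ.+ m C suc i)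
      ≡⟨ cong ((- + 1) ^ suc i *_) (ℤP.pos-+ (m C i) _) ⟩
    (- + 1) ^ suc i * (+ (m C i) + + (m C suc i))
      ≡⟨ ℤP.*-distribˡ-+ ((- + 1) ^ suc i) _ _ ⟩
    (- + 1) ^ suc i * + (m C i) + (- + 1) ^ suc i * + (m C suc i)
      ≡⟨ cong (_+ (- + 1) ^ suc i * + (m C suc i)) (ℤP.*-assoc (- + 1) ((- + 1) ^ i) (+ (m C i))) ⟩
    - + 1 * ((- + 1) ^ i * + (m C i)) + (- + 1) ^ suc i * + (m C suc i) ∎
  A≡1+B : A ≡ + 1 + B
  A≡1+B = begin
    A                                               ≡⟨ ℤP.+-identityʳ A ⟨
    A + + 0                                         ≡⟨ cong (_+_ A) last-term-vanishes ⟨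
    sumTo (suc m) (λ i → (- + 1) ^ i * + (m C i))   ≡⟨ sumTo-suc m _ ⟩
    + 1 + B                                         ∎
    where
    last-term-vanishes : (- + 1) ^ suc m * + (m C suc m) ≡ + 0
    last-term-vanishes = trans (cong (λ c → (- + 1) ^ suc m * + c) (k>n⇒nCk≡0 (ℕP.n<1+n m)))
                               (ℤP.*-zeroʳ ((- + 1) ^ suc m))
  cancel : ∀ b → + 1 + (- + 1 * (+ 1 + b) + b) ≡ + 0
  cancel = solve-∀

C-chain : ∀ {n k l j} → l ≤ k → j ≤ k → k ≤ n →
  ((n ∸ l) C (n ∸ j)) ℕ.* ((n ∸ j) C (n ∸ k)) ≡ ((n ∸ l) C (n ∸ k)) ℕ.* ((k ∸ l) C (k ∸ j))
C-chain {n} {k} {l} {j} l≤k j≤k k≤n with ℕP.≤-<-connex l j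
... | inj₁ l≤j =
  subst₂ (λ a b → ((n ∸ l) C (n ∸ j)) ℕ.* ((n ∸ j) C (n ∸ k)) ≡ ((n ∸ l) C (n ∸ k)) ℕ.* (a C b))
         ([n∸l]∸[n∸k]≡k∸l l≤k k≤n) ([n∸l]∸[n∸k]≡k∸l j≤k k≤n)
         (nCk*kCj≡nCj*[n∸j]C[k∸j] (ℕP.∸-monoʳ-≤ n j≤k) (ℕP.∸-monoʳ-≤ n l≤j))
... | inj₂ j<l = begin
  ((n ∸ l) C (n ∸ j)) ℕ.* ((n ∸ j) C (n ∸ k))
    ≡⟨ cong (ℕ._* ((n ∸ j) C (n ∸ k))) (k>n⇒nCk≡0 (ℕP.∸-monoʳ-< j<l (ℕP.≤-trans l≤k k≤n))) ⟩
  0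
    ≡⟨ ℕP.*-zeroʳ ((n ∸ l) C (n ∸ k)) ⟨
  ((n ∸ l) C (n ∸ k)) ℕ.* 0
    ≡⟨ cong (((n ∸ l) C (n ∸ k)) ℕ.*_) (k>n⇒nCk≡0 (ℕP.∸-monoʳ-< j<l l≤k)) ⟨
  ((n ∸ l) C (n ∸ k)) ℕ.* ((k ∸ l) C (k ∸ j)) ∎

-1^[a+a+i]≡-1^i : ∀ a i → (- + 1) ^ (a ℕ.+ a ℕ.+ i) ≡ (- + 1) ^ i
-1^[a+a+i]≡-1^i zero    i = refl
-1^[a+a+i]≡-1^i (suc a) i = begin
  (- + 1) ^ suc (a ℕ.+ suc a ℕ.+ i)           ≡⟨ cong (λ e → (- + 1) ^ suc (e ℕ.+ i)) (ℕP.+-suc a a) ⟩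
  - + 1 * (- + 1 * (- + 1) ^ (a ℕ.+ a ℕ.+ i)) ≡⟨ square (((- + 1) ^ (a ℕ.+ a ℕ.+ i))) ⟩
  (- + 1) ^ (a ℕ.+ a ℕ.+ i)                   ≡⟨ -1^[a+a+i]≡-1^i a i ⟩
  (- + 1) ^ i                                 ∎
  where
  square : ∀ x → - + 1 * (- + 1 * x) ≡ x
  square = solve-∀

reversed-alternating-sum : ∀ {l k} → l ≤ k →
  sumTo k (λ j → (- + 1) ^ (k ℕ.+ j) * + ((k ∸ l) C (k ∸ j))) ≡ 0ℤ ^ (k ∸ l)
reversed-alternating-sum {l} {k} l≤k = begin
  sumTo k g                                   ≡⟨ sumTo-reverse k g ⟨
  sumTo k (λ i → g (k ∸ i))                   ≡⟨ sumTo-cong k reindex ⟩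
  sumTo k (λ i → (- + 1) ^ i * + (m C i))     ≡⟨ sumTo-truncate _ (ℕP.m∸n≤m k l) vanishing ⟩
  sumTo m (λ i → (- + 1) ^ i * + (m C i))     ≡⟨ alternating-binomial-sum m ⟩
  0ℤ ^ m                                      ∎
  where
  m = k ∸ l
  g : ℕ → ℤ
  g j = (- + 1) ^ (k ℕ.+ j) * + (m C (k ∸ j))
  reindex : ∀ i → i ≤ k → g (k ∸ i) ≡ (- + 1) ^ i * + (m C i)
  reindex i i≤k = cong₂ _*_ parity (cong (λ r → + (m C r)) (ℕP.m∸[m∸n]≡n i≤k))
    where
    exponent : k ℕ.+ (k ∸ i) ≡ (k ∸ i) ℕ.+ (k ∸ i) ℕ.+ i
    exponent = trans (cong (ℕ._+ (k ∸ i)) (sym (ℕP.m∸n+n≡m i≤k))) (rearrange (k ∸ i) i)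
      where
      rearrange : ∀ d i → d ℕ.+ i ℕ.+ d ≡ d ℕ.+ d ℕ.+ i
      rearrange = ℕ-Ring.solve-∀
    parity : (- + 1) ^ (k ℕ.+ (k ∸ i)) ≡ (- + 1) ^ i
    parity = trans (cong ((- + 1) ^_) exponent) (-1^[a+a+i]≡-1^i (k ∸ i) i)
  vanishing : ∀ i → m < i → i ≤ k → (- + 1) ^ i * + (m C i) ≡ + 0
  vanishing i m<i _ = trans (cong (λ c → (- + 1) ^ i * + c) (k>n⇒nCk≡0 m<i)) (ℤP.*-zeroʳ ((- + 1) ^ i))

binomial-inversion : ∀ n (s : ℕ → ℤ) {k} → k ≤ n →
  sumTo k (λ j → (- + 1) ^ (k ℕ.+ j) * sumTo j (λ l → s l * + ((n ∸ l) C (n ∸ j))) * + ((n ∸ j) C (n ∸ k)))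
    ≡ s k
binomial-inversion n s {k} k≤n = begin
  sumTo k (λ j → σ j * sumTo j (λ l → s l * c l j) * c j k)
    ≡⟨ sumTo-cong k (λ j j≤k → cong (λ r → σ j * r * c j k) (extend j≤k)) ⟩
  sumTo k (λ j → σ j * sumTo k (λ l → s l * c l j) * c j k)
    ≡⟨ sumTo-cong k (λ j _ → distribute j) ⟩
  sumTo k (λ j → sumTo k (λ l → s l * (σ j * c l j * c j k)))
    ≡⟨ sumTo-swap k k _ ⟩
  sumTo k (λ l → sumTo k (λ j → s l * (σ j * c l j * c j k)))
    ≡⟨ sumTo-cong k (λ l l≤k → trans (sumTo-*ˡ k (s l) _)
                                     (trans (cong (s l *_) (orthogonality l≤k)) (ℤP.*-comm (s l) _))) ⟩
  sumTo k (λ l → 𝟙 (does (k ℕP.≟ l)) * s l)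
    ≡⟨ sumTo-δ k s ℕP.≤-refl ⟩
  s k ∎
  where
  σ : ℕ → ℤ
  σ j = (- + 1) ^ (k ℕ.+ j)
  c : ℕ → ℕ → ℤ
  c a b = + ((n ∸ a) C (n ∸ b))
  extend : ∀ {j} → j ≤ k → sumTo j (λ l → s l * c l j) ≡ sumTo k (λ l → s l * c l j)
  extend {j} j≤k = sym (sumTo-truncate _ j≤k (λ l j<l l≤k →
    trans (cong (λ r → s l * + r) (k>n⇒nCk≡0 (ℕP.∸-monoʳ-< j<l (ℕP.≤-trans l≤k k≤n))))
          (ℤP.*-zeroʳ (s l))))
  distribute : ∀ j → σ j * sumTo k (λ l → s l * c l j) * c j k ≡ sumTo k (λ l → s l * (σ j * c l j * c j k))
  distribute j = begin
    σ j * sumTo k (λ l → s l * c l j) * c j k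
      ≡⟨ cong (_* c j k) (sumTo-*ˡ k (σ j) _) ⟨
    sumTo k (λ l → σ j * (s l * c l j)) * c j k
      ≡⟨ sumTo-*ʳ k (c j k) _ ⟨
    sumTo k (λ l → σ j * (s l * c l j) * c j k)
      ≡⟨ sumTo-cong k (λ l _ → rearrange (σ j) (s l) (c l j) (c j k)) ⟩
    sumTo k (λ l → s l * (σ j * c l j * c j k)) ∎
    where
    rearrange : ∀ a b d e → a * (b * d) * e ≡ b * (a * d * e)
    rearrange = solve-∀
  orthogonality : ∀ {l} → l ≤ k → sumTo k (λ j → σ j * c l j * c j k) ≡ 𝟙 (does (k ℕP.≟ l))
  orthogonality {l} l≤k = begin
    sumTo k (λ j → σ j * c l j * c j k)
      ≡⟨ sumTo-cong k (λ j j≤k → chain j≤k) ⟩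
    sumTo k (λ j → c l k * (σ j * + ((k ∸ l) C (k ∸ j))))
      ≡⟨ sumTo-*ˡ k (c l k) _ ⟩
    c l k * sumTo k (λ j → σ j * + ((k ∸ l) C (k ∸ j)))
      ≡⟨ cong (c l k *_) (reversed-alternating-sum l≤k) ⟩
    c l k * 0ℤ ^ (k ∸ l)
      ≡⟨ Kronecker (ℕP.m≤n⇒m<n∨m≡n l≤k) ⟩
    𝟙 (does (k ℕP.≟ l)) ∎
    where
    chain : ∀ {j} → j ≤ k → σ j * c l j * c j k ≡ c l k * (σ j * + ((k ∸ l) C (k ∸ j)))
    chain {j} j≤k = begin
      σ j * c l j * c j k
        ≡⟨ ℤP.*-assoc (σ j) (c l j) (c j k) ⟩
      σ j * (c l j * c j k)
        ≡⟨ cong (σ j *_) (begin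
            + ((n ∸ l) C (n ∸ j)) * + ((n ∸ j) C (n ∸ k))   ≡⟨ ℤP.pos-* ((n ∸ l) C (n ∸ j)) _ ⟨
            + (((n ∸ l) C (n ∸ j)) ℕ.* ((n ∸ j) C (n ∸ k))) ≡⟨ cong +_ (C-chain l≤k j≤k k≤n) ⟩
            + (((n ∸ l) C (n ∸ k)) ℕ.* ((k ∸ l) C (k ∸ j))) ≡⟨ ℤP.pos-* ((n ∸ l) C (n ∸ k)) _ ⟩
            + ((n ∸ l) C (n ∸ k)) * + ((k ∸ l) C (k ∸ j))   ∎) ⟩
      σ j * (c l k * + ((k ∸ l) C (k ∸ j)))
        ≡⟨ ℤ*.x∙yz≈y∙xz (σ j) (c l k) _ ⟩
      c l k * (σ j * + ((k ∸ l) C (k ∸ j))) ∎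
    Kronecker : l < k ⊎ l ≡ k → c l k * 0ℤ ^ (k ∸ l) ≡ 𝟙 (does (k ℕP.≟ l))
    -- for l < k, rewriting k ∸ l to a successor makes 0ℤ ^ (k ∸ l) vanish
    Kronecker (inj₁ l<k) rewrite ℕP.+-∸-assoc 1 l<k | dec-false (k ℕP.≟ l) (ℕP.>⇒≢ l<k) = ℤP.*-zeroʳ (c l k)
    Kronecker (inj₂ refl) rewrite ℕP.n∸n≡0 l | nCn≡1 (n ∸ l) | dec-true (l ℕP.≟ l) refl = refl

sum-allSubsets-suc : ∀ n (f : Subset (suc n) → ℤ) →
  sumOver (allSubsets (suc n)) f ≡ (∑[ S ∈ allSubsets n ] f (false ∷ S)) + (∑[ S ∈ allSubsets n ] f (true ∷ S))
sum-allSubsets-suc n f = trans (sumOver-++ (map (false ∷_) (allSubsets n)) _ f)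
                               (cong₂ _+_ (sumOver-map _ (allSubsets n) f) (sumOver-map _ (allSubsets n) f))

sum-allSubsets-++ : ∀ m k (f : Subset (m ℕ.+ k) → ℤ) →
  sumOver (allSubsets (m ℕ.+ k)) f ≡ ∑[ A ∈ allSubsets m ] ∑[ B ∈ allSubsets k ] f (A ++ B)
sum-allSubsets-++ zero    k f = sym (ℤP.+-identityʳ _)
sum-allSubsets-++ (suc m) k f = begin
  sumOver (allSubsets (suc m ℕ.+ k)) f
    ≡⟨ sum-allSubsets-suc (m ℕ.+ k) f ⟩
  (∑[ S ∈ allSubsets (m ℕ.+ k) ] f (false ∷ S)) + (∑[ S ∈ allSubsets (m ℕ.+ k) ] f (true ∷ S))
    ≡⟨ cong₂ _+_ (sum-allSubsets-++ m k _) (sum-allSubsets-++ m k _) ⟩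
  (∑[ A ∈ allSubsets m ] ∑[ B ∈ allSubsets k ] f (false ∷ A ++ B))
    + (∑[ A ∈ allSubsets m ] ∑[ B ∈ allSubsets k ] f (true ∷ A ++ B))
    ≡⟨ sym (sum-allSubsets-suc m _) ⟩
  ∑[ A ∈ allSubsets (suc m) ] ∑[ B ∈ allSubsets k ] f (A ++ B) ∎

allSubsets-complete : ∀ {n} (S : Subset n) → S ∈ₗ allSubsets n
allSubsets-complete []          = here refl
allSubsets-complete (false ∷ S) = ∈ₗ.∈-++⁺ˡ (∈ₗ.∈-map⁺ (false ∷_) (allSubsets-complete S))
allSubsets-complete (true ∷ S)  =
  ∈ₗ.∈-++⁺ʳ (map (false ∷_) (allSubsets _)) (∈ₗ.∈-map⁺ (true ∷_) (allSubsets-complete S))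

∣p++q∣≡∣p∣+∣q∣ : ∀ {m k} (p : Subset m) (q : Subset k) → ∣ p ++ q ∣ ≡ ∣ p ∣ ℕ.+ ∣ q ∣
∣p++q∣≡∣p∣+∣q∣ []          q = refl
∣p++q∣≡∣p∣+∣q∣ (true ∷ p)  q = cong suc (∣p++q∣≡∣p∣+∣q∣ p q)
∣p++q∣≡∣p∣+∣q∣ (false ∷ p) q = ∣p++q∣≡∣p∣+∣q∣ p q

∣p∣≡0⇒p≡∅ : ∀ {n} (p : Subset n) → ∣ p ∣ ≡ 0 → p ≡ ∅
∣p∣≡0⇒p≡∅ []          _ = refl
∣p∣≡0⇒p≡∅ (false ∷ p) e = cong (false ∷_) (∣p∣≡0⇒p≡∅ p e)

countOfSize : ∀ {n} {P : Subset n → Set} → (∀ S → Dec (P S)) → ℕ → ℕ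
countOfSize {n} P? k = length (filter (λ S → P? S ×-dec (∣ S ∣ ℕP.≟ k)) (allSubsets n))

module _ {n} {P : Subset n → Set} (P? : ∀ S → Dec (P S)) where

  countOfSize-sum : ∀ k → + countOfSize P? k ≡ ∑[ S ∈ allSubsets n ] 𝟙 (does (P? S)) * 𝟙 (does (∣ S ∣ ℕP.≟ k))
  countOfSize-sum k = trans (length-filter _ (allSubsets n))
    (sumOver-cong (allSubsets n) (λ S → 𝟙-∧ (does (P? S)) (does (∣ S ∣ ℕP.≟ k))))

  sum-by-size : ∀ (h : ℕ → ℤ) →
    ∑[ S ∈ allSubsets n ] 𝟙 (does (P? S)) * h ∣ S ∣ ≡ sumTo n (λ j → + countOfSize P? j * h j)
  sum-by-size h = sym (begin
    sumTo n (λ j → + countOfSize P? j * h j)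
      ≡⟨ sumTo-cong n (λ j _ → trans (cong (_* h j) (countOfSize-sum j)) (sym (sumOver-*ʳ (allSubsets n) (h j) _))) ⟩
    sumTo n (λ j → ∑[ S ∈ allSubsets n ] p S * 𝟙 (does (∣ S ∣ ℕP.≟ j)) * h j)
      ≡⟨ sym (sumOver-sumTo (allSubsets n) n _) ⟩
    ∑[ S ∈ allSubsets n ] sumTo n (λ j → p S * 𝟙 (does (∣ S ∣ ℕP.≟ j)) * h j)
      ≡⟨ sumOver-cong (allSubsets n) collapse ⟩
    ∑[ S ∈ allSubsets n ] p S * h ∣ S ∣ ∎)
    where
    p : Subset n → ℤ
    p S = 𝟙 (does (P? S))
    collapse : ∀ S → sumTo n (λ j → p S * 𝟙 (does (∣ S ∣ ℕP.≟ j)) * h j) ≡ p S * h ∣ S ∣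
    collapse S = begin
      sumTo n (λ j → p S * 𝟙 (does (∣ S ∣ ℕP.≟ j)) * h j)
        ≡⟨ sumTo-cong n (λ j _ → ℤP.*-assoc (p S) _ (h j)) ⟩
      sumTo n (λ j → p S * (𝟙 (does (∣ S ∣ ℕP.≟ j)) * h j))
        ≡⟨ sumTo-*ˡ n (p S) _ ⟩
      p S * sumTo n (λ j → 𝟙 (does (∣ S ∣ ℕP.≟ j)) * h j)
        ≡⟨ cong (p S *_) (sumTo-δ n h (∣p∣≤n S)) ⟩
      p S * h ∣ S ∣ ∎

  countOfSize-zero : P ∅ → countOfSize P? 0 ≡ 1
  countOfSize-zero P∅ = ℤP.+-injective (begin
    + countOfSize P? 0
      ≡⟨ countOfSize-sum 0 ⟩
    ∑[ S ∈ allSubsets n ] 𝟙 (does (P? S)) * 𝟙 (does (∣ S ∣ ℕP.≟ 0))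
      ≡⟨ sumOver-cong (allSubsets n) only-∅ ⟩
    ∑[ S ∈ allSubsets n ] 𝟙 (does (∣ S ∣ ℕP.≟ 0))
      ≡⟨ size-zero-count n ⟩
    + 1 ∎)
    where
    only-∅ : ∀ S → 𝟙 (does (P? S)) * 𝟙 (does (∣ S ∣ ℕP.≟ 0)) ≡ 𝟙 (does (∣ S ∣ ℕP.≟ 0))
    only-∅ S with ∣ S ∣ in ∣S∣≡k
    ... | zero  = cong (λ b → 𝟙 b * + 1) (dec-true (P? S) (subst P (sym (∣p∣≡0⇒p≡∅ S ∣S∣≡k)) P∅))
    ... | suc _ = ℤP.*-zeroʳ (𝟙 (does (P? S)))
    size-zero-count : ∀ m → ∑[ S ∈ allSubsets m ] 𝟙 (does (∣ S ∣ ℕP.≟ 0)) ≡ + 1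
    size-zero-count zero    = refl
    size-zero-count (suc m) = trans (sum-allSubsets-suc m _)
      (cong₂ _+_ (size-zero-count m) (sumOver-zero (allSubsets m) (λ _ → refl)))

disjoint : ∀ {n} → Subset n → Subset n → Bool
disjoint []          []          = true
disjoint (true ∷ p)  (true ∷ q)  = false
disjoint (true ∷ p)  (false ∷ q) = disjoint p q
disjoint (false ∷ p) (_ ∷ q)     = disjoint p q

disjoint-sound : ∀ {n} (p q : Subset n) → T (disjoint p q) → ∀ {i} → i ∈ p → ¬ i ∈ q
disjoint-sound (true ∷ p)  (false ∷ q) d (there i∈p) (there i∈q) = disjoint-sound p q d i∈p i∈q
disjoint-sound (false ∷ p) (_ ∷ q)     d (there i∈p) (there i∈q) = disjoint-sound p q d i∈p i∈q

disjoint-complete : ∀ {n} (p q : Subset n) → (∀ {i} → i ∈ p → ¬ i ∈ q) → T (disjoint p q)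
disjoint-complete []          []          _   = _
disjoint-complete (true ∷ p)  (true ∷ q)  p#q = p#q here here
disjoint-complete (true ∷ p)  (false ∷ q) p#q = disjoint-complete p q (λ i∈p i∈q → p#q (there i∈p) (there i∈q))
disjoint-complete (false ∷ p) (_ ∷ q)     p#q = disjoint-complete p q (λ i∈p i∈q → p#q (there i∈p) (there i∈q))

disjoint⇒∣p∣+∣q∣≤n : ∀ {n} (p q : Subset n) → T (disjoint p q) → ∣ p ∣ ℕ.+ ∣ q ∣ ≤ n
disjoint⇒∣p∣+∣q∣≤n []          []          _ = z≤n
disjoint⇒∣p∣+∣q∣≤n (true ∷ p)  (false ∷ q) d = s≤s (disjoint⇒∣p∣+∣q∣≤n p q d)
disjoint⇒∣p∣+∣q∣≤n (false ∷ p) (false ∷ q) d = ℕP.m≤n⇒m≤1+n (disjoint⇒∣p∣+∣q∣≤n p q d)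
disjoint⇒∣p∣+∣q∣≤n {suc n} (false ∷ p) (true ∷ q) d =
  subst (_≤ suc n) (sym (ℕP.+-suc ∣ p ∣ ∣ q ∣)) (s≤s (disjoint⇒∣p∣+∣q∣≤n p q d))

disjoint-∅-full : ∀ n → T (disjoint (∅ {n}) full)
disjoint-∅-full zero    = _
disjoint-∅-full (suc n) = disjoint-∅-full n

count-disjoint-of-size : ∀ {n} (A : Subset n) m →
  ∑[ B ∈ allSubsets n ] 𝟙 (disjoint A B) * 𝟙 (does (∣ B ∣ ℕP.≟ m)) ≡ + (∣ ∁ A ∣ C m)
count-disjoint-of-size []          zero    = refl
count-disjoint-of-size []          (suc m) = refl
count-disjoint-of-size {suc n} (true ∷ A) m = trans (sum-allSubsets-suc n _)
  (trans (cong₂ _+_ (count-disjoint-of-size A m) (sumOver-zero (allSubsets n) (λ _ → refl))) (ℤP.+-identityʳ _))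
count-disjoint-of-size {suc n} (false ∷ A) m = trans (sum-allSubsets-suc n _) (add-new-element m)
  where
  k = ∣ ∁ A ∣
  add-new-element : ∀ m → (∑[ B ∈ allSubsets n ] 𝟙 (disjoint A B) * 𝟙 (does (∣ B ∣ ℕP.≟ m)))
                        + (∑[ B ∈ allSubsets n ] 𝟙 (disjoint A B) * 𝟙 (does (suc ∣ B ∣ ℕP.≟ m)))
                        ≡ + (suc k C m)
  add-new-element zero    = cong₂ _+_ (count-disjoint-of-size A 0)
                                      (sumOver-zero (allSubsets n) (λ B → ℤP.*-zeroʳ (𝟙 (disjoint A B))))
  add-new-element (suc m) = begin
    _ ≡⟨ cong₂ _+_ (count-disjoint-of-size A (suc m)) (count-disjoint-of-size A m) ⟩
    + (k C suc m) + + (k C m) ≡⟨ sym (ℤP.pos-+ (k C suc m) _) ⟩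
    + (k C suc m ℕ.+ k C m)   ≡⟨ cong +_ (ℕP.+-comm (k C suc m) _) ⟩
    + (k C m ℕ.+ k C suc m)   ≡⟨ cong +_ (nCk+nC[k+1]≡[n+1]C[k+1] k m) ⟩
    + (suc k C suc m)         ∎

disjoint-generating-function : ∀ {n} (A : Subset n) x →
  ∑[ B ∈ allSubsets n ] 𝟙 (disjoint A B) * x ^ ∣ B ∣ ≡ (+ 1 + x) ^ ∣ ∁ A ∣
disjoint-generating-function []          x = refl
disjoint-generating-function {suc n} (true ∷ A) x = trans (sum-allSubsets-suc n _)
  (trans (cong₂ _+_ (disjoint-generating-function A x) (sumOver-zero (allSubsets n) (λ _ → refl))) (ℤP.+-identityʳ _))
disjoint-generating-function {suc n} (false ∷ A) x = begin
  ∑[ B ∈ allSubsets (suc n) ] 𝟙 (disjoint (false ∷ A) B) * x ^ ∣ B ∣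
    ≡⟨ sum-allSubsets-suc n _ ⟩
  (∑[ B ∈ allSubsets n ] 𝟙 (disjoint A B) * x ^ ∣ B ∣)
    + (∑[ B ∈ allSubsets n ] 𝟙 (disjoint A B) * (x * x ^ ∣ B ∣))
    ≡⟨ cong (_+_ (∑[ B ∈ allSubsets n ] 𝟙 (disjoint A B) * x ^ ∣ B ∣))
            (trans (sumOver-cong (allSubsets n) (λ B → ℤ*.x∙yz≈y∙xz (𝟙 (disjoint A B)) x _))
                   (sumOver-*ˡ (allSubsets n) x _)) ⟩
  P + x * P
    ≡⟨ cong (λ y → y + x * y) (disjoint-generating-function A x) ⟩
  (+ 1 + x) ^ ∣ ∁ A ∣ + x * (+ 1 + x) ^ ∣ ∁ A ∣
    ≡⟨ factor x ((+ 1 + x) ^ ∣ ∁ A ∣) ⟩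
  (+ 1 + x) * (+ 1 + x) ^ ∣ ∁ A ∣ ∎
  where
  P = ∑[ B ∈ allSubsets n ] 𝟙 (disjoint A B) * x ^ ∣ B ∣
  factor : ∀ x y → y + x * y ≡ (+ 1 + x) * y
  factor = solve-∀

count-disjoint-of-union-size : ∀ {n} (A : Subset n) {k} → k ≤ n →
  ∑[ B ∈ allSubsets n ] 𝟙 (disjoint A B) * 𝟙 (does (∣ A ∣ ℕ.+ ∣ B ∣ ℕP.≟ k))
    ≡ + ((n ∸ ∣ A ∣) C (n ∸ k))
count-disjoint-of-union-size {n} A {k} k≤n with ℕP.≤-<-connex ∣ A ∣ k
... | inj₁ ∣A∣≤k = begin
  ∑[ B ∈ allSubsets n ] 𝟙 (disjoint A B) * 𝟙 (does (∣ A ∣ ℕ.+ ∣ B ∣ ℕP.≟ k))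
    ≡⟨ sumOver-cong (allSubsets n) (λ B → cong (λ b → 𝟙 (disjoint A B) * 𝟙 b)
                                               (does-⇔ (rest B) (_ ℕP.≟ k) (∣ B ∣ ℕP.≟ k ∸ ∣ A ∣))) ⟩
  ∑[ B ∈ allSubsets n ] 𝟙 (disjoint A B) * 𝟙 (does (∣ B ∣ ℕP.≟ k ∸ ∣ A ∣))
    ≡⟨ count-disjoint-of-size A (k ∸ ∣ A ∣) ⟩
  + (∣ ∁ A ∣ C (k ∸ ∣ A ∣))
    ≡⟨ cong (λ r → + (r C (k ∸ ∣ A ∣))) (∣∁p∣≡n∸∣p∣ A) ⟩
  + ((n ∸ ∣ A ∣) C (k ∸ ∣ A ∣))
    ≡⟨ cong +_ (nCk≡nC[n∸k] (ℕP.∸-monoˡ-≤ ∣ A ∣ k≤n)) ⟩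
  + ((n ∸ ∣ A ∣) C ((n ∸ ∣ A ∣) ∸ (k ∸ ∣ A ∣)))
    ≡⟨ cong (λ r → + ((n ∸ ∣ A ∣) C r)) ([n∸a]∸[k∸a]≡n∸k n ∣A∣≤k) ⟩
  + ((n ∸ ∣ A ∣) C (n ∸ k)) ∎
  where
  rest : ∀ B → (∣ A ∣ ℕ.+ ∣ B ∣ ≡ k) ⇔ (∣ B ∣ ≡ k ∸ ∣ A ∣)
  rest B = mk⇔ (λ e → trans (sym (ℕP.m+n∸m≡n ∣ A ∣ ∣ B ∣)) (cong (_∸ ∣ A ∣) e))
               (λ e → trans (cong (∣ A ∣ ℕ.+_) e) (ℕP.m+[n∸m]≡n ∣A∣≤k))
... | inj₂ k<∣A∣ = begin
  ∑[ B ∈ allSubsets n ] 𝟙 (disjoint A B) * 𝟙 (does (∣ A ∣ ℕ.+ ∣ B ∣ ℕP.≟ k))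
    ≡⟨ sumOver-zero (allSubsets n) (λ B → trans (cong (λ b → 𝟙 (disjoint A B) * 𝟙 b) (too-big B))
                                                (ℤP.*-zeroʳ (𝟙 (disjoint A B)))) ⟩
  + 0
    ≡⟨ cong +_ (sym (k>n⇒nCk≡0 (ℕP.∸-monoʳ-< k<∣A∣ (∣p∣≤n A)))) ⟩
  + ((n ∸ ∣ A ∣) C (n ∸ k)) ∎
  where
  too-big : ∀ B → does (∣ A ∣ ℕ.+ ∣ B ∣ ℕP.≟ k) ≡ false
  too-big B = dec-false (_ ℕP.≟ k) (ℕP.>⇒≢ (ℕP.<-≤-trans k<∣A∣ (ℕP.m≤m+n ∣ A ∣ ∣ B ∣)))

∈-++ˡ : ∀ {m n} {A : Subset m} {B : Subset n} {i} → i ∈ A → (i ↑ˡ n) ∈ A ++ B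
∈-++ˡ here      = here
∈-++ˡ (there h) = there (∈-++ˡ h)

∈-++ʳ : ∀ {m n} (A : Subset m) {B : Subset n} {j} → j ∈ B → (m ↑ʳ j) ∈ A ++ B
∈-++ʳ []      h = h
∈-++ʳ (_ ∷ A) h = there (∈-++ʳ A h)

∈-++⁻ : ∀ {m n} (A : Subset m) {B : Subset n} {x} → x ∈ A ++ B → [ _∈ A , _∈ B ]′ (splitAt m x)
∈-++⁻ []      h    = h
∈-++⁻ (_ ∷ A) here = here
∈-++⁻ {suc m} (_ ∷ A) {x = Fin.suc x} (there h) with splitAt m x | ∈-++⁻ A h
... | inj₁ _ | h′ = there h′
... | inj₂ _ | h′ = h′

module _ {n} (G : Graph n) where

  stable-star-edge : ∀ {S u v} → Stable (star G) S → join n n u ∈ S → join n n v ∈ S → starAdj′ G u v ≡ false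
  stable-star-edge {u = u} {v} st u∈S v∈S =
    subst₂ (λ u′ v′ → starAdj′ G u′ v′ ≡ false) (FinP.splitAt-join n n u) (FinP.splitAt-join n n v)
           (st _ u∈S _ v∈S)

  stable-star⁻ : ∀ {A B} → Stable (star G) (A ++ B) → Stable G A × T (disjoint A B)
  stable-star⁻ {A} {B} st =
      (λ i i∈A j j∈A → stable-star-edge {u = inj₁ i} {inj₁ j} st (∈-++ˡ i∈A) (∈-++ˡ j∈A))
    , disjoint-complete A B (λ {i} i∈A i∈B →
        subst T (stable-star-edge {u = inj₁ i} {inj₂ i} st (∈-++ˡ i∈A) (∈-++ʳ A i∈B)) (fromWitness refl))

  stable-star⁺ : ∀ {A B} → Stable G A → T (disjoint A B) → Stable (star G) (A ++ B)
  stable-star⁺ {A} {B} stA A#B x x∈S y y∈S = edge (splitAt n x) (splitAt n y) (∈-++⁻ A x∈S) (∈-++⁻ A y∈S)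
    where
    apart : ∀ {i j} → i ≢ j → ⌊ i FinP.≟ j ⌋ ≡ false
    apart {i} {j} i≢j = trans (isYes≗does (i FinP.≟ j)) (dec-false (i FinP.≟ j) i≢j)
    edge : ∀ u v → [ _∈ A , _∈ B ]′ u → [ _∈ A , _∈ B ]′ v → starAdj′ G u v ≡ false
    edge (inj₁ i) (inj₁ j) i∈A j∈A = stA i i∈A j j∈A
    edge (inj₁ i) (inj₂ j) i∈A j∈B = apart λ { refl → disjoint-sound A B A#B i∈A j∈B }
    edge (inj₂ i) (inj₁ j) i∈B j∈A = apart λ { refl → disjoint-sound A B A#B j∈A i∈B }
    edge (inj₂ i) (inj₂ j) _   _   = refl

  stable?-star : ∀ A B → does (stable? (star G) (A ++ B)) ≡ does (stable? G A) ∧ disjoint A B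
  stable?-star A B = does-⇔ (mk⇔ stable-star⁻ (λ (stA , A#B) → stable-star⁺ stA A#B))
                            (stable? (star G) (A ++ B)) (stable? G A ×-dec T? (disjoint A B))

  sum-stable-star : ∀ (f : Subset (n ℕ.+ n) → ℤ) →
    ∑[ S ∈ allSubsets (n ℕ.+ n) ] 𝟙 (does (stable? (star G) S)) * f S
      ≡ ∑[ A ∈ allSubsets n ] 𝟙 (does (stable? G A)) * (∑[ B ∈ allSubsets n ] 𝟙 (disjoint A B) * f (A ++ B))
  sum-stable-star f = begin
    ∑[ S ∈ allSubsets (n ℕ.+ n) ] 𝟙 (does (stable? (star G) S)) * f S
      ≡⟨ sum-allSubsets-++ n n _ ⟩
    ∑[ A ∈ allSubsets n ] ∑[ B ∈ allSubsets n ] 𝟙 (does (stable? (star G) (A ++ B))) * f (A ++ B)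
      ≡⟨ sumOver-cong (allSubsets n) (λ A → trans (sumOver-cong (allSubsets n) (factor A))
           (sumOver-*ˡ (allSubsets n) (𝟙 (does (stable? G A))) (λ B → 𝟙 (disjoint A B) * f (A ++ B)))) ⟩
    ∑[ A ∈ allSubsets n ] 𝟙 (does (stable? G A)) * (∑[ B ∈ allSubsets n ] 𝟙 (disjoint A B) * f (A ++ B)) ∎
    where
    factor : ∀ A B → 𝟙 (does (stable? (star G) (A ++ B))) * f (A ++ B)
                   ≡ 𝟙 (does (stable? G A)) * (𝟙 (disjoint A B) * f (A ++ B))
    factor A B = begin
      𝟙 (does (stable? (star G) (A ++ B))) * f (A ++ B)
        ≡⟨ cong (λ b → 𝟙 b * f (A ++ B)) (stable?-star A B) ⟩
      𝟙 (does (stable? G A) ∧ disjoint A B) * f (A ++ B)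
        ≡⟨ cong (_* f (A ++ B)) (𝟙-∧ (does (stable? G A)) (disjoint A B)) ⟩
      𝟙 (does (stable? G A)) * 𝟙 (disjoint A B) * f (A ++ B)
        ≡⟨ ℤP.*-assoc (𝟙 (does (stable? G A))) _ _ ⟩
      𝟙 (does (stable? G A)) * (𝟙 (disjoint A B) * f (A ++ B)) ∎

∅-stable : ∀ {n} (G : Graph n) → Stable G ∅
∅-stable G i i∈∅ = ⊥-elim (∉⊥ i∈∅)

∈⇒≤max : ∀ {x xs} → x ∈ₗ xs → x ≤ foldr ℕ._⊔_ 0 xs
∈⇒≤max {xs = y ∷ ys} (here refl) = ℕP.m≤m⊔n y _
∈⇒≤max {xs = y ∷ ys} (there x∈)  = ℕP.≤-trans (∈⇒≤max x∈) (ℕP.m≤n⊔m y _)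

all≤⇒max≤ : ∀ {N xs} → All (_≤ N) xs → foldr ℕ._⊔_ 0 xs ≤ N
all≤⇒max≤ []             = z≤n
all≤⇒max≤ (x≤N ∷ xs≤N) = ℕP.⊔-lub x≤N (all≤⇒max≤ xs≤N)

module _ {n} (G : Graph n) where

  stable⇒∣S∣≤α : ∀ {S} → Stable G S → ∣ S ∣ ≤ α G
  stable⇒∣S∣≤α {S} st = ∈⇒≤max (∈ₗ.∈-map⁺ ∣_∣ (∈ₗ.∈-filter⁺ (stable? G) (allSubsets-complete S) st))

  α≤ : ∀ {N} → (∀ {S} → Stable G S → ∣ S ∣ ≤ N) → α G ≤ N
  α≤ bound = all≤⇒max≤ (map⁺ (All.map bound (all-filter (stable? G) (allSubsets n))))

  α≤n : α G ≤ n
  α≤n = α≤ (λ {S} _ → ∣p∣≤n S)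

  stableCount-above-α : ∀ {k} → α G < k → stableCount G k ≡ 0
  stableCount-above-α α<k = cong length (filter-none _ (All.universal too-big (allSubsets n)))
    where
    too-big : ∀ S → ¬ (Stable G S × ∣ S ∣ ≡ _)
    too-big S (st , refl) = ℕP.<-irrefl refl (ℕP.≤-<-trans (stable⇒∣S∣≤α st) α<k)

  sumTo-stableCount-α : ∀ {N} (h : ℕ → ℤ) → α G ≤ N →
    sumTo N (λ j → + stableCount G j * h j) ≡ sumTo (α G) (λ j → + stableCount G j * h j)
  sumTo-stableCount-α h α≤N = sumTo-truncate _ α≤N (λ j α<j _ → cong (λ c → + c * h j) (stableCount-above-α α<j))

α-star : ∀ {n} (G : Graph n) → α (star G) ≡ n
α-star {n} G = ℕP.≤-antisym (α≤ (star G) star-bound)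
                            (subst (_≤ α (star G)) ∣∅++full∣≡n (stable⇒∣S∣≤α (star G) ∅++full-stable))
  where
  star-bound : ∀ {S} → Stable (star G) S → ∣ S ∣ ≤ n
  star-bound {S} st with Vec.splitAt n S
  ... | A , B , refl = subst (_≤ n) (sym (∣p++q∣≡∣p∣+∣q∣ A B))
                             (disjoint⇒∣p∣+∣q∣≤n A B (proj₂ (stable-star⁻ G {A} {B} st)))
  ∅++full-stable : Stable (star G) (∅ {n} ++ full {n})
  ∅++full-stable = stable-star⁺ G (∅-stable G) (disjoint-∅-full n)
  ∣∅++full∣≡n : ∣ ∅ {n} ++ full {n} ∣ ≡ n
  ∣∅++full∣≡n = trans (∣p++q∣≡∣p∣+∣q∣ (∅ {n}) (full {n})) (cong₂ ℕ._+_ (∣⊥∣≡0 n) (∣⊤∣≡n n))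

module _ {n} (G : Graph n) where

  stableCount-star-sumTo-n : ∀ {k} → k ≤ n →
    + stableCount (star G) k ≡ sumTo n (λ j → + stableCount G j * + ((n ∸ j) C (n ∸ k)))
  stableCount-star-sumTo-n {k} k≤n = begin
    + stableCount (star G) k
      ≡⟨ countOfSize-sum (stable? (star G)) k ⟩
    ∑[ S ∈ allSubsets (n ℕ.+ n) ] 𝟙 (does (stable? (star G) S)) * 𝟙 (does (∣ S ∣ ℕP.≟ k))
      ≡⟨ sum-stable-star G _ ⟩
    ∑[ A ∈ allSubsets n ] 𝟙 (does (stable? G A))
                            * (∑[ B ∈ allSubsets n ] 𝟙 (disjoint A B) * 𝟙 (does (∣ A ++ B ∣ ℕP.≟ k)))
      ≡⟨ sumOver-cong (allSubsets n) (λ A → cong (𝟙 (does (stable? G A)) *_) (extensions A)) ⟩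
    ∑[ A ∈ allSubsets n ] 𝟙 (does (stable? G A)) * + ((n ∸ ∣ A ∣) C (n ∸ k))
      ≡⟨ sum-by-size (stable? G) (λ j → + ((n ∸ j) C (n ∸ k))) ⟩
    sumTo n (λ j → + stableCount G j * + ((n ∸ j) C (n ∸ k))) ∎
    where
    extensions : ∀ A → ∑[ B ∈ allSubsets n ] 𝟙 (disjoint A B) * 𝟙 (does (∣ A ++ B ∣ ℕP.≟ k))
                       ≡ + ((n ∸ ∣ A ∣) C (n ∸ k))
    extensions A = trans (sumOver-cong (allSubsets n) (λ B → cong (λ m → 𝟙 (disjoint A B) * 𝟙 (does (m ℕP.≟ k)))
                                                                  (∣p++q∣≡∣p∣+∣q∣ A B)))
                         (count-disjoint-of-union-size A k≤n)

  independence-star : ∀ x →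
    I (star G) x ≡ sumTo (α G) (λ k → + stableCount G k * x ^ k * (+ 1 + x) ^ (n ∸ k))
  independence-star x = begin
    sumTo (α (star G)) (λ k → + stableCount (star G) k * x ^ k)
      ≡⟨ sym (sumTo-stableCount-α (star G) (x ^_) (α≤n (star G))) ⟩
    sumTo (n ℕ.+ n) (λ k → + stableCount (star G) k * x ^ k)
      ≡⟨ sym (sum-by-size (stable? (star G)) (x ^_)) ⟩
    ∑[ S ∈ allSubsets (n ℕ.+ n) ] 𝟙 (does (stable? (star G) S)) * x ^ ∣ S ∣
      ≡⟨ sum-stable-star G _ ⟩
    ∑[ A ∈ allSubsets n ] 𝟙 (does (stable? G A)) * (∑[ B ∈ allSubsets n ] 𝟙 (disjoint A B) * x ^ ∣ A ++ B ∣)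
      ≡⟨ sumOver-cong (allSubsets n) (λ A → cong (𝟙 (does (stable? G A)) *_) (extensions A)) ⟩
    ∑[ A ∈ allSubsets n ] 𝟙 (does (stable? G A)) * (x ^ ∣ A ∣ * (+ 1 + x) ^ (n ∸ ∣ A ∣))
      ≡⟨ sum-by-size (stable? G) (λ k → x ^ k * (+ 1 + x) ^ (n ∸ k)) ⟩
    sumTo n (λ k → + stableCount G k * (x ^ k * (+ 1 + x) ^ (n ∸ k)))
      ≡⟨ sumTo-stableCount-α G _ (α≤n G) ⟩
    sumTo (α G) (λ k → + stableCount G k * (x ^ k * (+ 1 + x) ^ (n ∸ k)))
      ≡⟨ sumTo-cong (α G) (λ k _ → ℤP.*-assoc (+ stableCount G k) (x ^ k) _) ⟨
    sumTo (α G) (λ k → + stableCount G k * x ^ k * (+ 1 + x) ^ (n ∸ k)) ∎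
    where
    extensions : ∀ A → ∑[ B ∈ allSubsets n ] 𝟙 (disjoint A B) * x ^ ∣ A ++ B ∣
                       ≡ x ^ ∣ A ∣ * (+ 1 + x) ^ (n ∸ ∣ A ∣)
    extensions A = begin
      ∑[ B ∈ allSubsets n ] 𝟙 (disjoint A B) * x ^ ∣ A ++ B ∣
        ≡⟨ sumOver-cong (allSubsets n) (λ B → trans
             (cong (λ m → 𝟙 (disjoint A B) * x ^ m) (∣p++q∣≡∣p∣+∣q∣ A B))
             (cong (𝟙 (disjoint A B) *_) (ℤP.^-distribˡ-+-* x ∣ A ∣ ∣ B ∣))) ⟩
      ∑[ B ∈ allSubsets n ] 𝟙 (disjoint A B) * (x ^ ∣ A ∣ * x ^ ∣ B ∣)
        ≡⟨ sumOver-cong (allSubsets n) (λ B → ℤ*.x∙yz≈y∙xz (𝟙 (disjoint A B)) (x ^ ∣ A ∣) _) ⟩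
      ∑[ B ∈ allSubsets n ] x ^ ∣ A ∣ * (𝟙 (disjoint A B) * x ^ ∣ B ∣)
        ≡⟨ sumOver-*ˡ (allSubsets n) (x ^ ∣ A ∣) _ ⟩
      x ^ ∣ A ∣ * (∑[ B ∈ allSubsets n ] 𝟙 (disjoint A B) * x ^ ∣ B ∣)
        ≡⟨ cong (x ^ ∣ A ∣ *_) (disjoint-generating-function A x) ⟩
      x ^ ∣ A ∣ * (+ 1 + x) ^ ∣ ∁ A ∣
        ≡⟨ cong (λ m → x ^ ∣ A ∣ * (+ 1 + x) ^ m) (∣∁p∣≡n∸∣p∣ A) ⟩
      x ^ ∣ A ∣ * (+ 1 + x) ^ (n ∸ ∣ A ∣) ∎

  stableCount-star : ∀ {k} → k ≤ n →
    + stableCount (star G) k ≡ sumTo k (λ j → + stableCount G j * + ((n ∸ j) C (n ∸ k)))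
  stableCount-star {k} k≤n = trans (stableCount-star-sumTo-n k≤n) (sumTo-truncate _ k≤n (λ j k<j j≤n →
    trans (cong (λ c → + stableCount G j * + c) (k>n⇒nCk≡0 (ℕP.∸-monoʳ-< k<j j≤n)))
          (ℤP.*-zeroʳ (+ stableCount G j))))

  stableCount-starℕ : ∀ {k} → k ≤ n →
    stableCount (star G) k ≡ sumToℕ k (λ j → stableCount G j ℕ.* ((n ∸ j) C (n ∸ k)))
  stableCount-starℕ {k} k≤n = ℤP.+-injective (begin
    + stableCount (star G) k
      ≡⟨ stableCount-star k≤n ⟩
    sumTo k (λ j → + stableCount G j * + ((n ∸ j) C (n ∸ k)))
      ≡⟨ sumTo-cong k (λ j _ → ℤP.pos-* (stableCount G j) _) ⟨
    sumTo k (λ j → + (stableCount G j ℕ.* ((n ∸ j) C (n ∸ k))))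
      ≡⟨ sumToℕ-to-ℤ k _ ⟨
    + sumToℕ k (λ j → stableCount G j ℕ.* ((n ∸ j) C (n ∸ k))) ∎)

  stableCount-from-star : ∀ {k} → k ≤ α G →
    + stableCount G k ≡ sumTo k (λ j → (- + 1) ^ (k ℕ.+ j) * + stableCount (star G) j * + ((n ∸ j) C (n ∸ k)))
  stableCount-from-star {k} k≤α = sym (trans
    (sumTo-cong k (λ j j≤k → cong (λ r → (- + 1) ^ (k ℕ.+ j) * r * + ((n ∸ j) C (n ∸ k)))
                                  (stableCount-star (ℕP.≤-trans j≤k k≤n))))
    (binomial-inversion n (λ j → + stableCount G j) k≤n))
    where
    k≤n = ℕP.≤-trans k≤α (α≤n G)

  stableCount-star-top : stableCount (star G) n ≡ sumToℕ (α G) (stableCount G)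
  stableCount-star-top = ℤP.+-injective (begin
    + stableCount (star G) n
      ≡⟨ stableCount-star-sumTo-n ℕP.≤-refl ⟩
    sumTo n (λ j → + stableCount G j * + ((n ∸ j) C (n ∸ n)))
      ≡⟨ sumTo-cong n (λ j _ → cong (λ r → + stableCount G j * + ((n ∸ j) C r)) (ℕP.n∸n≡0 n)) ⟩
    sumTo n (λ j → + stableCount G j * + 1)
      ≡⟨ sumTo-stableCount-α G _ (α≤n G) ⟩
    sumTo (α G) (λ j → + stableCount G j * + 1)
      ≡⟨ sumTo-cong (α G) (λ j _ → ℤP.*-identityʳ _) ⟩
    sumTo (α G) (λ j → + stableCount G j)
      ≡⟨ sumToℕ-to-ℤ (α G) _ ⟨
    + sumToℕ (α G) (stableCount G) ∎)

  stableCount-star-increasing : ∀ {i} → suc i ℕ.+ i ≤ n → stableCount (star G) i ≤ stableCount (star G) (suc i)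
  stableCount-star-increasing {i} 1+2i≤n = subst₂ _≤_
    (sym (stableCount-starℕ (ℕP.<⇒≤ i<n))) (sym (stableCount-starℕ i<n))
    (ℕP.≤-trans (sumToℕ-mono-≤ i (λ j _ → ℕP.*-monoʳ-≤ (stableCount G j) (C-step-down j 1+2i≤n)))
                (ℕP.m≤m+n _ _))
    where
    i<n : suc i ≤ n
    i<n = ℕP.≤-trans (ℕP.m≤m+n (suc i) i) 1+2i≤n

  independence-star-factored : ∀ x → I (star G) x
    ≡ (+ 1 + x) ^ (α (star G) ∸ α G) * sumTo (α G) (λ k → + stableCount G k * x ^ k * (+ 1 + x) ^ (α G ∸ k))
  independence-star-factored x = begin
    I (star G) x
      ≡⟨ independence-star x ⟩
    sumTo (α G) (λ k → + stableCount G k * x ^ k * (+ 1 + x) ^ (n ∸ k))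
      ≡⟨ sumTo-cong (α G) (λ k k≤α → split k k≤α) ⟩
    sumTo (α G) (λ k → (+ 1 + x) ^ (n ∸ α G) * (+ stableCount G k * x ^ k * (+ 1 + x) ^ (α G ∸ k)))
      ≡⟨ sumTo-*ˡ (α G) ((+ 1 + x) ^ (n ∸ α G)) _ ⟩
    (+ 1 + x) ^ (n ∸ α G) * sumTo (α G) (λ k → + stableCount G k * x ^ k * (+ 1 + x) ^ (α G ∸ k))
      ≡⟨ cong (λ m → (+ 1 + x) ^ (m ∸ α G) * sumTo (α G) (λ k → + stableCount G k * x ^ k * (+ 1 + x) ^ (α G ∸ k)))
              (α-star G) ⟨
    (+ 1 + x) ^ (α (star G) ∸ α G) * sumTo (α G) (λ k → + stableCount G k * x ^ k * (+ 1 + x) ^ (α G ∸ k)) ∎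
    where
    split : ∀ k → k ≤ α G → + stableCount G k * x ^ k * (+ 1 + x) ^ (n ∸ k)
                           ≡ (+ 1 + x) ^ (n ∸ α G) * (+ stableCount G k * x ^ k * (+ 1 + x) ^ (α G ∸ k))
    split k k≤α = begin
      + stableCount G k * x ^ k * (+ 1 + x) ^ (n ∸ k)
        ≡⟨ cong (λ e → + stableCount G k * x ^ k * (+ 1 + x) ^ e) (n∸l≡[n∸k]+[k∸l] k≤α (α≤n G)) ⟩
      + stableCount G k * x ^ k * (+ 1 + x) ^ ((n ∸ α G) ℕ.+ (α G ∸ k))
        ≡⟨ cong (+ stableCount G k * x ^ k *_) (ℤP.^-distribˡ-+-* (+ 1 + x) (n ∸ α G) (α G ∸ k)) ⟩
      + stableCount G k * x ^ k * ((+ 1 + x) ^ (n ∸ α G) * (+ 1 + x) ^ (α G ∸ k))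
        ≡⟨ ℤ*.x∙yz≈y∙xz (+ stableCount G k * x ^ k) ((+ 1 + x) ^ (n ∸ α G)) _ ⟩
      (+ 1 + x) ^ (n ∸ α G) * (+ stableCount G k * x ^ k * (+ 1 + x) ^ (α G ∸ k)) ∎

theorem3 : ∀ (n : ℕ) (G : Graph n) →
  let t = stableCount (star G)
      s = stableCount G
  in α (star G) ≡ n
   × (∀ (x : ℤ) → I (star G) x
        ≡ sumTo (α G) (λ k → + s k * (x ^ k) * ((+ 1 + x) ^ (n ∸ k))))
   × (∀ (x : ℤ) → I (star G) x
        ≡ (+ 1 + x) ^ (α (star G) ∸ α G)
          * sumTo (α G) (λ k → + s k * (x ^ k) * ((+ 1 + x) ^ (α G ∸ k))))
   × (∀ k → k ≤ n → t k ≡ sumToℕ k (λ j → s j Data.Nat.* ((n ∸ j) C (n ∸ k))))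
   × (∀ k → k ≤ α G → + s k ≡ sumTo k (λ j → ((- + 1) ^ (k Data.Nat.+ j)) * + t j * + ((n ∸ j) C (n ∸ k))))
   × t 0 ≡ 1
   × t n ≡ sumToℕ (α G) s
   × (∀ i → i < ⌈ n /2⌉ → t i ≤ t (suc i))
theorem3 n G =
    α-star G
  , independence-star G
  , independence-star-factored G
  , (λ k → stableCount-starℕ G)
  , (λ k → stableCount-from-star G)
  , countOfSize-zero (stable? (star G)) (∅-stable (star G))
  , stableCount-star-top G
  , (λ i i<⌈n/2⌉ → stableCount-star-increasing G (<⌈n/2⌉⇒1+i+i≤n n i i<⌈n/2⌉))
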